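{- Let $q$ be a prime power, $m$ a positive integer and $i$ a positive integer. If $U$ is an $\mathbb{F}_q$-subspace of $\mathbb{F}_{q^m}^2$ of dimension $n$ such that $L_U$ is an $i$-club in $\mathrm{PG}(1,q^m)$, then $n\le m$ if $i\le m-1$, and $n\le m+1$ if $i=m$.
   Context: $L_U=\{\langle u\rangle_{\mathbb{F}_{q^m}} : u\in U\setminus\{0\}\}$; the weight of a point $\langle v\rangle_{\mathbb{F}_{q^m}}$ is $\dim_{\mathbb{F}_q}(U\cap\langle v\rangle_{\mathbb{F}_{q^m}})$; $L_U$ is an $i$-club if exactly one point of $L_U$ has weight $i$ and all others weight $1$. -}

module Defs where

open import Level using (0ℓ)
open import Data.Nat using (ℕ; suc; _^_)
open import Data.Nat.Primality using (Prime)
open import Data.Fin using (Fin)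
open import Data.Vec using (Vec; []; _∷_)
open import Data.Vec.Relation.Unary.All using (All)
open import Data.Product using (Σ; _×_; _,_; ∃; ∃-syntax; proj₁)
open import Relation.Nullary using (¬_)
open import Relation.Binary.Bundles using (Setoid)
import Relation.Binary.PropositionalEquality as ≡
open import Function.Bundles using (Inverse)
open import Algebra.Bundles using (CommutativeRing)

IsPrimePower : ℕ → Set
IsPrimePower q = ∃[ p ] ∃[ k ] (Prime p × (q ≡.≡ p ^ suc k))

HasCard : Setoid 0ℓ 0ℓ → ℕ → Set
HasCard S N = Inverse (≡.setoid (Fin N)) S

module _ (K : CommutativeRing 0ℓ 0ℓ) where
  open CommutativeRing K

  IsField : Set
  IsField = (¬ (1# ≈ 0#)) × (∀ x → ¬ (x ≈ 0#) → ∃[ y ] (x * y ≈ 1#))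

  SubSetoid : (Carrier → Set) → Setoid 0ℓ 0ℓ
  SubSetoid P = record
    { Carrier = Σ Carrier P
    ; _≈_ = λ a b → proj₁ a ≈ proj₁ b
    ; isEquivalence = record
        { refl = refl ; sym = sym ; trans = trans } }

  record IsSubfield (F : Carrier → Set) : Set where
    field
      resp  : ∀ {x y} → x ≈ y → F x → F y
      has0  : F 0#
      has1  : F 1#
      +-cl  : ∀ {x y} → F x → F y → F (x + y)
      neg-cl : ∀ {x} → F x → F (- x)
      *-cl  : ∀ {x y} → F x → F y → F (x * y)
      inv-cl : ∀ {x y} → F x → ¬ (x ≈ 0#) → x * y ≈ 1# → F y

  V : Set
  V = Carrier × Carrier

  _≈V_ : V → V → Set
  (a , b) ≈V (c , d) = (a ≈ c) × (b ≈ d)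

  0V : V
  0V = (0# , 0#)

  _+V_ : V → V → V
  (a , b) +V (c , d) = (a + c , b + d)

  _·_ : Carrier → V → V
  λ' · (a , b) = (λ' * a , λ' * b)

  record IsSubspace (F : Carrier → Set) (U : V → Set) : Set where
    field
      resp  : ∀ {v w} → v ≈V w → U v → U w
      has0  : U 0V
      +-cl  : ∀ {v w} → U v → U w → U (v +V w)
      ·-cl  : ∀ {a v} → F a → U v → U (a · v)

  lincomb : ∀ {d} → Vec Carrier d → Vec V d → V
  lincomb [] [] = 0V
  lincomb (c ∷ cs) (b ∷ bs) = (c · b) +V lincomb cs bs

  HasDim : (F : Carrier → Set) → (V → Set) → ℕ → Set
  HasDim F W d = ∃[ bs ] (All W bs
    × (∀ (cs : Vec Carrier d) → All F cs → lincomb cs bs ≈V 0V → All (_≈ 0#) cs)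
    × (∀ w → W w → ∃[ cs ] (All F cs × (w ≈V lincomb cs bs))))

  -- the point ⟨v⟩_K of PG(1, K), as the set of K-multiples of v
  ⟨_⟩ : V → V → Set
  ⟨ v ⟩ w = ∃[ a ] (w ≈V (a · v))

  _∩_ : (V → Set) → (V → Set) → V → Set
  (A ∩ B) w = A w × B w

  HasWeight : (F : Carrier → Set) → (U : V → Set) → V → ℕ → Set
  HasWeight F U v k = HasDim F (U ∩ ⟨ v ⟩) k

  -- L_U is an i-club: exactly one point of L_U (here ⟨u⟩) has weight i,
  -- all other points ⟨w⟩ (w ∈ U∖{0}, ⟨w⟩ ≠ ⟨u⟩) have weight 1 (and not i).
  IsClub : (F : Carrier → Set) → (U : V → Set) → ℕ → Set
  IsClub F U i = ∃[ u ] (U u × ¬ (u ≈V 0V) × HasWeight F U u i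
    × (∀ w → U w → ¬ (w ≈V 0V) → ¬ (⟨ u ⟩ w)
         → HasWeight F U w 1 × ¬ HasWeight F U w i))

{-# OPTIONS --safe #-}
module Submission where

-- Coordinates with respect to a basis enumerate the q ^ n vectors of U. A vector of U either lies
-- on the point ⟨u⟩ of weight i, where U ∩ ⟨u⟩ has q ^ i vectors, or it is a nonzero vector on
-- another of the q ^ m + 1 points of PG(1, q ^ m). Such a point has weight 1, so the vectors of U
-- on it are the q − 1 nonzero F-multiples of a single representative. Hence
-- q ^ n ≤ q ^ i + (q ^ m + 1)(q − 1), and both bounds on n follow by arithmetic.

open import Defs
  using (IsPrimePower; HasCard; IsField; SubSetoid; IsSubfield; V; IsSubspace; HasDim; HasWeight; IsClub)
import Defs
open import Level using (0ℓ)
open import Data.Nat using (ℕ; zero; suc; _^_)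
open import Data.Fin using (Fin; zero; suc; punchOut; combine; remQuot)
import Data.Fin.Properties as FinP
open FinP using (+↔⊎; *↔×)
open import Data.Product using (Σ; ∃; ∃-syntax; _×_; _,_; proj₁; proj₂)
open import Data.Sum using (_⊎_; inj₁; inj₂)
open import Data.Sum.Properties using (inj₁-injective; inj₂-injective)
open import Data.Vec using (Vec; []; _∷_; zipWith)
open import Data.Vec.Relation.Unary.All using (All; []; _∷_)
open import Data.Vec.Relation.Binary.Pointwise.Inductive using (Pointwise; []; _∷_)
open import Function using (_∘_)
open import Function.Bundles using (Inverse)
open import Relation.Nullary using (¬_; ¬?; Dec; yes; no; contradiction)
open import Relation.Nullary.Decidable using (decidable-stable; map′; _×-dec_)
open import Relation.Unary using (Decidable)
open import Relation.Binary.Bundles using (Setoid)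
import Relation.Binary.PropositionalEquality as ≡
open ≡ using (_≡_; _≢_)
open import Algebra.Bundles using (CommutativeRing)

module _ {S : Setoid 0ℓ 0ℓ} {N : ℕ} (card : HasCard S N) where
  open Setoid S
  open Inverse card using (to; from; from-cong; strictlyInverseˡ)

  from-injective : ∀ {x y} → from x ≡ from y → x ≈ y
  from-injective {x} {y} eq =
    trans (sym (strictlyInverseˡ x)) (trans (reflexive (≡.cong to eq)) (strictlyInverseˡ y))

  ≈-decidable : ∀ x y → Dec (x ≈ y)
  ≈-decidable x y = map′ from-injective from-cong (from x FinP.≟ from y)

module _ {S : Setoid 0ℓ 0ℓ} {N : ℕ} (card : HasCard S (suc N)) (z : Setoid.Carrier S) where
  open Setoid S
  open Inverse card using (from)

  private
    from-≢ : ∀ {x} → ¬ x ≈ z → from z ≢ from x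
    from-≢ x≉z eq = x≉z (sym (from-injective card eq))

  fromWithout : (x : Carrier) → ¬ x ≈ z → Fin N
  fromWithout x x≉z = punchOut (from-≢ x≉z)

  fromWithout-injective : ∀ {x y} (x≉z : ¬ x ≈ z) (y≉z : ¬ y ≈ z) →
                          fromWithout x x≉z ≡ fromWithout y y≉z → x ≈ y
  fromWithout-injective x≉z y≉z eq =
    from-injective card (FinP.punchOut-injective (from-≢ x≉z) (from-≢ y≉z) eq)

module _ {A : Set} {N : ℕ} {P : A → Fin N → Set} (P? : ∀ a → Decidable (P a)) where

  choose : ∀ {a} → ∃ (P a) → ∃ (P a)
  choose {a} x = decidable-stable (FinP.any? (P? a)) (λ ¬x → ¬x x)

  choose-cong : ∀ {a b} → a ≡ b → (x : ∃ (P a)) (y : ∃ (P b)) →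
                proj₁ (choose x) ≡ proj₁ (choose y)
  choose-cong {a} ≡.refl x y with FinP.any? (P? a)
  ... | yes _ = ≡.refl
  ... | no ¬x = contradiction x ¬x

module Plane (K : CommutativeRing 0ℓ 0ℓ) where
  open CommutativeRing K hiding (zero)
  open import Algebra.Properties.Ring ring using (-‿distribˡ-*)
  open import Algebra.Properties.AbelianGroup +-abelianGroup using (⁻¹-∙-comm)
  open import Algebra.Properties.Group +-group using (x∙y⁻¹≈ε⇒x≈y; x≈y⇒x∙y⁻¹≈ε)
  open import Algebra.Properties.CommutativeSemigroup +-commutativeSemigroup using (interchange)
  open import Algebra.Properties.CommutativeSemigroup *-commutativeSemigroup
    using (xy∙z≈xz∙y; xy∙z≈y∙xz)
  open import Relation.Binary.Reasoning.Setoid setoid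

  infix 4 _≈V_
  infixl 6 _-V_
  infixr 7 _·_

  _≈V_ : V K → V K → Set
  _≈V_ = Defs._≈V_ K

  0V : V K
  0V = Defs.0V K

  _·_ : Carrier → V K → V K
  _·_ = Defs._·_ K

  lincomb : ∀ {d} → Vec Carrier d → Vec (V K) d → V K
  lincomb = Defs.lincomb K

  ⟨_⟩ : V K → V K → Set
  ⟨_⟩ = Defs.⟨_⟩ K

  _-V_ : V K → V K → V K
  (a , b) -V (c , d) = (a - c , b - d)

  ≈V-refl : ∀ {v} → v ≈V v
  ≈V-refl = refl , refl

  ≈V-reflexive : ∀ {v w} → v ≡ w → v ≈V w
  ≈V-reflexive ≡.refl = ≈V-refl

  ≈V-sym : ∀ {v w} → v ≈V w → w ≈V v
  ≈V-sym (e₁ , e₂) = sym e₁ , sym e₂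

  ≈V-trans : ∀ {u v w} → u ≈V v → v ≈V w → u ≈V w
  ≈V-trans (e₁ , e₂) (f₁ , f₂) = trans e₁ f₁ , trans e₂ f₂

  ·-cong : ∀ {a b v w} → a ≈ b → v ≈V w → a · v ≈V b · w
  ·-cong a≈b (e₁ , e₂) = *-cong a≈b e₁ , *-cong a≈b e₂

  ·-zeroˡ : ∀ {a} v → a ≈ 0# → a · v ≈V 0V
  ·-zeroˡ v a≈0 = trans (*-congʳ a≈0) (zeroˡ _) , trans (*-congʳ a≈0) (zeroˡ _)

  ≈·⇒scalar≉0 : ∀ {a v w} → w ≈V a · v → ¬ w ≈V 0V → ¬ a ≈ 0#
  ≈·⇒scalar≉0 {v = v} w≈av w≉0 a≈0 = w≉0 (≈V-trans w≈av (·-zeroˡ v a≈0))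

  ⟨⟩-refl : ∀ v → ⟨ v ⟩ v
  ⟨⟩-refl v = 1# , sym (*-identityˡ _) , sym (*-identityˡ _)

  ≈0V⇒∈⟨⟩ : ∀ v {w} → w ≈V 0V → ⟨ v ⟩ w
  ≈0V⇒∈⟨⟩ v w≈0 = 0# , ≈V-trans w≈0 (≈V-sym (·-zeroˡ v refl))

  lincomb-cong : ∀ {d} {cs ds : Vec Carrier d} (bs : Vec (V K) d) →
                 Pointwise _≈_ cs ds → lincomb cs bs ≈V lincomb ds bs
  lincomb-cong [] [] = ≈V-refl
  lincomb-cong (b ∷ bs) (c≈d ∷ cs≈ds) =
    let (e₁ , e₂) = lincomb-cong bs cs≈ds in +-cong (*-congʳ c≈d) e₁ , +-cong (*-congʳ c≈d) e₂

  lincomb-∈ : ∀ {F W} → IsSubspace K F W → ∀ {d} {cs : Vec Carrier d} {bs} →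
              All F cs → All W bs → W (lincomb cs bs)
  lincomb-∈ W-sub [] [] = IsSubspace.has0 W-sub
  lincomb-∈ W-sub (c∈ ∷ cs∈) (b∈ ∷ bs∈) =
    IsSubspace.+-cl W-sub (IsSubspace.·-cl W-sub c∈ b∈) (lincomb-∈ W-sub cs∈ bs∈)

  [x-y]*z+[u-v]≈[x*z+u]-[y*z+v] : ∀ x y z u v → (x - y) * z + (u - v) ≈ (x * z + u) - (y * z + v)
  [x-y]*z+[u-v]≈[x*z+u]-[y*z+v] x y z u v = begin
    (x - y) * z + (u - v)           ≈⟨ +-congʳ (distribʳ z x (- y)) ⟩
    (x * z + - y * z) + (u - v)     ≈⟨ +-congʳ (+-congˡ (sym (-‿distribˡ-* y z))) ⟩
    (x * z - y * z) + (u - v)       ≈⟨ interchange (x * z) (- (y * z)) u (- v) ⟩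
    (x * z + u) + (- (y * z) - v)   ≈⟨ +-congˡ (⁻¹-∙-comm (y * z) v) ⟩
    (x * z + u) - (y * z + v)       ∎

  lincomb-difference : ∀ {d} (cs ds : Vec Carrier d) bs →
                      lincomb (zipWith _-_ cs ds) bs ≈V lincomb cs bs -V lincomb ds bs
  lincomb-difference [] [] [] = sym (-‿inverseʳ 0#) , sym (-‿inverseʳ 0#)
  lincomb-difference (c ∷ cs) (d ∷ ds) (b ∷ bs) =
    let (e₁ , e₂) = lincomb-difference cs ds bs in
    trans (+-congˡ e₁) ([x-y]*z+[u-v]≈[x*z+u]-[y*z+v] c d _ _ _) ,
    trans (+-congˡ e₂) ([x-y]*z+[u-v]≈[x*z+u]-[y*z+v] c d _ _ _)

  ≈V⇒-V≈0V : ∀ {v w} → v ≈V w → v -V w ≈V 0V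
  ≈V⇒-V≈0V (e₁ , e₂) = x≈y⇒x∙y⁻¹≈ε e₁ , x≈y⇒x∙y⁻¹≈ε e₂

  module Field (fld : IsField K) where

    inv : (x : Carrier) → ¬ x ≈ 0# → Carrier
    inv x x≉0 = proj₁ (proj₂ fld x x≉0)

    *-inv : ∀ x (x≉0 : ¬ x ≈ 0#) → x * inv x x≉0 ≈ 1#
    *-inv x x≉0 = proj₂ (proj₂ fld x x≉0)

    inv-* : ∀ x (x≉0 : ¬ x ≈ 0#) → inv x x≉0 * x ≈ 1#
    inv-* x x≉0 = trans (*-comm _ x) (*-inv x x≉0)

    *-inv-cancelʳ : ∀ y x (x≉0 : ¬ x ≈ 0#) → y * x * inv x x≉0 ≈ y
    *-inv-cancelʳ y x x≉0 = trans (*-assoc y x _) (trans (*-congˡ (*-inv x x≉0)) (*-identityʳ y))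

    inv-*-cancelʳ : ∀ y x (x≉0 : ¬ x ≈ 0#) → y * inv x x≉0 * x ≈ y
    inv-*-cancelʳ y x x≉0 = trans (xy∙z≈xz∙y y _ x) (*-inv-cancelʳ y x x≉0)

    inv-*-cancel-middle : ∀ y x (x≉0 : ¬ x ≈ 0#) z → (y * inv x x≉0) * (x * z) ≈ y * z
    inv-*-cancel-middle y x x≉0 z = begin
      (y * inv x x≉0) * (x * z)   ≈⟨ *-assoc y _ (x * z) ⟩
      y * (inv x x≉0 * (x * z))   ≈⟨ *-congˡ (sym (*-assoc _ x z)) ⟩
      y * ((inv x x≉0 * x) * z)   ≈⟨ *-congˡ (*-congʳ (inv-* x x≉0)) ⟩
      y * (1# * z)                ≈⟨ *-congˡ (*-identityˡ z) ⟩
      y * z                       ∎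

    x*y≈0⇒y≈0 : ∀ {x y} → ¬ x ≈ 0# → x * y ≈ 0# → y ≈ 0#
    x*y≈0⇒y≈0 {x} {y} x≉0 xy≈0 = begin
      y                   ≈⟨ *-inv-cancelʳ y x x≉0 ⟨
      y * x * inv x x≉0   ≈⟨ *-congʳ (trans (*-comm y x) xy≈0) ⟩
      0# * inv x x≉0      ≈⟨ zeroˡ _ ⟩
      0#                  ∎

    cross⇒*-inv≈ : ∀ {x y x′ y′} (y≉0 : ¬ y ≈ 0#) (y′≉0 : ¬ y′ ≈ 0#) →
                   x * y′ ≈ x′ * y → x * inv y y≉0 ≈ x′ * inv y′ y′≉0
    cross⇒*-inv≈ {x} {y} {x′} {y′} y≉0 y′≉0 cross = begin
      x * inv y y≉0                          ≈⟨ *-congʳ (*-inv-cancelʳ x y′ y′≉0) ⟨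
      x * y′ * inv y′ y′≉0 * inv y y≉0       ≈⟨ *-congʳ (*-congʳ cross) ⟩
      x′ * y * inv y′ y′≉0 * inv y y≉0       ≈⟨ *-congʳ (xy∙z≈xz∙y x′ y _) ⟩
      x′ * inv y′ y′≉0 * y * inv y y≉0       ≈⟨ *-inv-cancelʳ _ y y≉0 ⟩
      x′ * inv y′ y′≉0                       ∎

    *-inv≈⇒cross : ∀ {x y x′ y′} (y≉0 : ¬ y ≈ 0#) (y′≉0 : ¬ y′ ≈ 0#) →
                   x * inv y y≉0 ≈ x′ * inv y′ y′≉0 → x * y′ ≈ x′ * y
    *-inv≈⇒cross {x} {y} {x′} {y′} y≉0 y′≉0 ratio = begin
      x * y′                          ≈⟨ *-congʳ (inv-*-cancelʳ x y y≉0) ⟨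
      x * inv y y≉0 * y * y′          ≈⟨ *-congʳ (*-congʳ ratio) ⟩
      x′ * inv y′ y′≉0 * y * y′       ≈⟨ xy∙z≈xz∙y _ y y′ ⟩
      x′ * inv y′ y′≉0 * y′ * y       ≈⟨ *-congʳ (inv-*-cancelʳ x′ y′ y′≉0) ⟩
      x′ * y                          ∎

    dim-one⇒multiple : ∀ {F W} → IsSubfield K F → HasDim K F W 1 →
                       ∀ {r v} → W r → ¬ r ≈V 0V → W v → ∃[ a ] F a × v ≈V a · r
    dim-one⇒multiple F-sub (b ∷ [] , _ , _ , span) {r} {v} r∈ r≉0 v∈
      with span r r∈ | span v v∈
    ... | c ∷ [] , c∈ ∷ [] , r≈cb | c′ ∷ [] , c′∈ ∷ [] , v≈c′b =
      c′ * inv c c≉0 ,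
      IsSubfield.*-cl F-sub c′∈ (IsSubfield.inv-cl F-sub c∈ c≉0 (*-inv c c≉0)) ,
      rescale (proj₁ r≈cb) (proj₁ v≈c′b) , rescale (proj₂ r≈cb) (proj₂ v≈c′b)
      where
      c≉0 : ¬ c ≈ 0#
      c≉0 c≈0 = r≉0 (≈V-trans r≈cb (trans (+-identityʳ _) (trans (*-congʳ c≈0) (zeroˡ _)) ,
                                     trans (+-identityʳ _) (trans (*-congʳ c≈0) (zeroˡ _))))

      rescale : ∀ {x x′ y} → x ≈ c * y + 0# → x′ ≈ c′ * y + 0# → x′ ≈ c′ * inv c c≉0 * x
      rescale {x} {x′} {y} x≈ x′≈ = begin
        x′                         ≈⟨ trans x′≈ (+-identityʳ _) ⟩
        c′ * y                     ≈⟨ inv-*-cancel-middle c′ c c≉0 y ⟨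
        c′ * inv c c≉0 * (c * y)   ≈⟨ *-congˡ (trans x≈ (+-identityʳ _)) ⟨
        c′ * inv c c≉0 * x         ∎

    module ProjectiveLine {Q : ℕ} (cardK : HasCard setoid Q) where
      open Inverse cardK using (from; from-cong)

      infix 4 _≈?_
      _≈?_ : ∀ x y → Dec (x ≈ y)
      _≈?_ = ≈-decidable cardK

      -- The slope b / a of ⟨ (a , b) ⟩, with zero for the point ⟨ (0 , 1) ⟩ at infinity;
      -- the zero vector is sent to zero as well.
      point : V K → Fin (suc Q)
      point (a , b) with a ≈? 0#
      ... | yes _   = zero
      ... | no a≉0 = suc (from (b * inv a a≉0))

      point-cong : ∀ {v w} → v ≈V w → point v ≡ point w
      point-cong {a , b} {c , d} (a≈c , b≈d) with a ≈? 0# | c ≈? 0#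
      ... | yes _   | yes _   = ≡.refl
      ... | yes a≈0 | no c≉0 = contradiction (trans (sym a≈c) a≈0) c≉0
      ... | no a≉0 | yes c≈0 = contradiction (trans a≈c c≈0) a≉0
      ... | no a≉0 | no c≉0 = ≡.cong suc (from-cong (cross⇒*-inv≈ a≉0 c≉0 (*-cong b≈d (sym a≈c))))

      point-· : ∀ {c} → ¬ c ≈ 0# → ∀ v → point (c · v) ≡ point v
      point-· {c} c≉0 (a , b) with c * a ≈? 0# | a ≈? 0#
      ... | yes _    | yes _   = ≡.refl
      ... | yes ca≈0 | no a≉0 = contradiction (x*y≈0⇒y≈0 c≉0 ca≈0) a≉0
      ... | no ca≉0 | yes a≈0 = contradiction (trans (*-congˡ a≈0) (zeroʳ c)) ca≉0
      ... | no ca≉0 | no a≉0 = ≡.cong suc (from-cong (cross⇒*-inv≈ ca≉0 a≉0 (xy∙z≈y∙xz c b a)))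

      point≡⇒∈⟨⟩ : ∀ {v w} → ¬ v ≈V 0V → point v ≡ point w → ⟨ v ⟩ w
      point≡⇒∈⟨⟩ {a , b} {c , d} v≉0 eq with a ≈? 0# | c ≈? 0#
      ... | yes a≈0 | yes c≈0 =
        d * inv b b≉0 , trans c≈0 (sym (trans (*-congˡ a≈0) (zeroʳ _))) , sym (inv-*-cancelʳ d b b≉0)
        where
        b≉0 : ¬ b ≈ 0#
        b≉0 b≈0 = v≉0 (a≈0 , b≈0)
      ... | no a≉0 | no c≉0 =
        c * inv a a≉0 , sym (inv-*-cancelʳ c a a≉0) , sym d≈
        where
        bc≈da : b * c ≈ d * a
        bc≈da = *-inv≈⇒cross a≉0 c≉0 (from-injective cardK (FinP.suc-injective eq))
        d≈ : c * inv a a≉0 * b ≈ d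
        d≈ = begin
          c * inv a a≉0 * b   ≈⟨ xy∙z≈xz∙y c _ b ⟩
          c * b * inv a a≉0   ≈⟨ *-congʳ (trans (*-comm c b) bc≈da) ⟩
          d * a * inv a a≉0   ≈⟨ *-inv-cancelʳ d a a≉0 ⟩
          d                   ∎

      ∈⟨⟩⇒point≡ : ∀ {v w} → ⟨ v ⟩ w → ¬ w ≈V 0V → point w ≡ point v
      ∈⟨⟩⇒point≡ {v} (a , w≈av) w≉0 =
        ≡.trans (point-cong w≈av) (point-· (≈·⇒scalar≉0 w≈av w≉0) v)

      ⟨⟩-dec : ∀ {v} → ¬ v ≈V 0V → ∀ w → Dec (⟨ v ⟩ w)
      ⟨⟩-dec {v} v≉0 w with (proj₁ w ≈? 0#) ×-dec (proj₂ w ≈? 0#)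
      ... | yes w≈0 = yes (≈0V⇒∈⟨⟩ v w≈0)
      ... | no w≉0 =
        map′ (point≡⇒∈⟨⟩ v≉0 ∘ ≡.sym) (λ w∈ → ∈⟨⟩⇒point≡ w∈ w≉0) (point w FinP.≟ point v)

  module Coordinates {F : Carrier → Set} {q : ℕ} (cardF : HasCard (SubSetoid K F) q) where
    private
      module CF = Inverse cardF

      element : Fin q → Carrier
      element k = proj₁ (CF.to k)

      element-injective : ∀ {k k′} → element k ≈ element k′ → k ≡ k′
      element-injective {k} {k′} e =
        ≡.trans (≡.sym (CF.strictlyInverseʳ k)) (≡.trans (CF.from-cong e) (CF.strictlyInverseʳ k′))

      split : ∀ {d} → Fin (q ^ suc d) → Fin q × Fin (q ^ d)
      split {d} = remQuot {q} (q ^ d)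

    coords : ∀ {d} → Fin (q ^ d) → Vec Carrier d
    coords {zero}  _ = []
    coords {suc d} j = element (proj₁ (split {d} j)) ∷ coords {d} (proj₂ (split {d} j))

    coords-∈ : ∀ {d} (j : Fin (q ^ d)) → All F (coords {d} j)
    coords-∈ {zero}  _ = []
    coords-∈ {suc d} j = proj₂ (CF.to (proj₁ (split {d} j))) ∷ coords-∈ {d} (proj₂ (split {d} j))

    coords-injective : ∀ {d} (j j′ : Fin (q ^ d)) →
                       Pointwise _≈_ (coords {d} j) (coords {d} j′) → j ≡ j′
    coords-injective {zero}  zero zero [] = ≡.refl
    coords-injective {suc d} j j′ (e ∷ es) =
      ≡.trans (≡.sym (FinP.combine-remQuot {q} (q ^ d) j))
        (≡.trans (≡.cong₂ combine (element-injective e) (coords-injective {d} _ _ es))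
          (FinP.combine-remQuot {q} (q ^ d) j′))

    coords-combine : ∀ {d} k (j : Fin (q ^ d)) → coords {suc d} (combine k j) ≡ element k ∷ coords {d} j
    coords-combine {d} k j =
      ≡.cong (λ (k′ , j′) → element k′ ∷ coords {d} j′) (FinP.remQuot-combine k j)

    code : ∀ {d} (cs : Vec Carrier d) → All F cs → Fin (q ^ d)
    code []       []         = zero
    code (c ∷ cs) (c∈ ∷ cs∈) = combine (CF.from (c , c∈)) (code cs cs∈)

    coords-code : ∀ {d} (cs : Vec Carrier d) (cs∈ : All F cs) →
                  Pointwise _≈_ (coords {d} (code cs cs∈)) cs
    coords-code []       []         = []
    coords-code (c ∷ cs) (c∈ ∷ cs∈) =
      ≡.subst (λ xs → Pointwise _≈_ xs (c ∷ cs))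
        (≡.sym (coords-combine (CF.from (c , c∈)) (code cs cs∈)))
        (CF.strictlyInverseˡ (c , c∈) ∷ coords-code cs cs∈)

    module Basis {W : V K → Set} {d : ℕ} (dim : HasDim K F W d) where
      private
        basis : Vec (V K) d
        basis = proj₁ dim

      decode : Fin (q ^ d) → V K
      decode j = lincomb (coords j) basis

      decode-∈ : IsSubspace K F W → ∀ j → W (decode j)
      decode-∈ W-sub j = lincomb-∈ W-sub (coords-∈ j) (proj₁ (proj₂ dim))

      decode-injective : IsSubfield K F → ∀ {j j′} → decode j ≈V decode j′ → j ≡ j′
      decode-injective F-sub {j} {j′} eq =
        coords-injective j j′
          (differences≈0 (coords j) (coords j′) (independent _ differences∈F difference≈0V))
        where
        independent = proj₁ (proj₂ (proj₂ dim))

        difference≈0V : lincomb (zipWith _-_ (coords j) (coords j′)) basis ≈V 0V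
        difference≈0V = ≈V-trans (lincomb-difference (coords j) (coords j′) basis) (≈V⇒-V≈0V eq)

        differences-∈ : ∀ {k} {cs ds : Vec Carrier k} → All F cs → All F ds → All F (zipWith _-_ cs ds)
        differences-∈ []         []         = []
        differences-∈ (c∈ ∷ cs∈) (d∈ ∷ ds∈) =
          IsSubfield.+-cl F-sub c∈ (IsSubfield.neg-cl F-sub d∈) ∷ differences-∈ cs∈ ds∈

        differences≈0 : ∀ {k} (cs ds : Vec Carrier k) →
                        All (_≈ 0#) (zipWith _-_ cs ds) → Pointwise _≈_ cs ds
        differences≈0 []       []       []         = []
        differences≈0 (c ∷ cs) (d ∷ ds) (e ∷ es) = x∙y⁻¹≈ε⇒x≈y c d e ∷ differences≈0 cs ds es

        differences∈F : All F (zipWith _-_ (coords j) (coords j′))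
        differences∈F = differences-∈ (coords-∈ j) (coords-∈ j′)

      encode : ∀ w → W w → Fin (q ^ d)
      encode w w∈ = let (cs , cs∈ , _) = proj₂ (proj₂ (proj₂ dim)) w w∈ in code cs cs∈

      decode-encode : ∀ w (w∈ : W w) → decode (encode w w∈) ≈V w
      decode-encode w w∈ =
        let (cs , cs∈ , w≈) = proj₂ (proj₂ (proj₂ dim)) w w∈ in
        ≈V-trans (lincomb-cong basis (coords-code cs cs∈)) (≈V-sym w≈)

      encode-injective : ∀ {w w′} (w∈ : W w) (w′∈ : W w′) →
                         encode w w∈ ≡ encode w′ w′∈ → w ≈V w′
      encode-injective {w} {w′} w∈ w′∈ eq =
        ≈V-trans (≈V-sym (decode-encode w w∈))
          (≈V-trans (≈V-reflexive (≡.cong decode eq)) (decode-encode w′ w′∈))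

open import Data.Nat
  using (_≤_; _<_; _+_; _*_; _∸_; s≤s; s≤s⁻¹; NonZero; >-nonZero⁻¹; nonTrivial⇒n>1)
open import Data.Nat.Properties
  using (≤-refl; <-≤-trans; +-assoc; +-comm; *-comm; +-monoˡ-<; +-monoʳ-<; +-monoʳ-≤;
         *-monoˡ-≤; m<m*n; m≤m*n; m≤n*m; m^n≢0; ^-monoʳ-≤; ^-monoʳ-<; <⇒≱; ≮⇒≥; _<?_;
         module ≤-Reasoning)
open import Data.Nat.Primality using (prime⇒nonTrivial; prime⇒nonZero)

module ClubBound {K : CommutativeRing 0ℓ 0ℓ} (fld : IsField K)
                 {Q : ℕ} (cardK : HasCard (CommutativeRing.setoid K) Q)
                 {F : CommutativeRing.Carrier K → Set} (F-sub : IsSubfield K F)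
                 {p : ℕ} (cardF : HasCard (SubSetoid K F) (suc p))
                 {U : V K → Set} (U-sub : IsSubspace K F U) {n : ℕ} (dimU : HasDim K F U n)
                 {i : ℕ} (club : IsClub K F U i) where
  open CommutativeRing K using (Carrier; _≈_; 0#)
  open Plane K
  open Field fld
  open ProjectiveLine cardK
  open Coordinates cardF
  private
    module U = Basis dimU

  q : ℕ
  q = suc p

  u : V K
  u = proj₁ club

  u≉0 : ¬ u ≈V 0V
  u≉0 = proj₁ (proj₂ (proj₂ club))

  module S = Basis (proj₁ (proj₂ (proj₂ (proj₂ club))))

  weight-one : ∀ w → U w → ¬ w ≈V 0V → ¬ ⟨ u ⟩ w → HasWeight K F U w 1
  weight-one w w∈ w≉0 w∉ = proj₁ (proj₂ (proj₂ (proj₂ (proj₂ club))) w w∈ w≉0 w∉)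

  zeroF : Σ Carrier F
  zeroF = 0# , IsSubfield.has0 F-sub

  vec : Fin (q ^ n) → V K
  vec = U.decode

  vec-∈ : ∀ j → U (vec j)
  vec-∈ = U.decode-∈ U-sub

  OnPoint : Fin (suc Q) → Fin (q ^ n) → Set
  OnPoint x j = point (vec j) ≡ x × ¬ ⟨ u ⟩ (vec j)

  onPoint? : ∀ x → Decidable (OnPoint x)
  onPoint? x j = (point (vec j) FinP.≟ x) ×-dec ¬? (⟨⟩-dec u≉0 (vec j))

  module Outside (j : Fin (q ^ n)) (j∉ : ¬ ⟨ u ⟩ (vec j)) where
    -- Depends on j only through point (vec j) (choose-cong), so all vectors of U on one point
    -- are measured against the same representative.
    representative : Fin (q ^ n)
    representative = proj₁ (choose onPoint? (j , ≡.refl , j∉))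

    private
      r : V K
      r = vec representative

      r-point : point r ≡ point (vec j)
      r-point = proj₁ (proj₂ (choose onPoint? (j , ≡.refl , j∉)))

      r∉ : ¬ ⟨ u ⟩ r
      r∉ = proj₂ (proj₂ (choose onPoint? (j , ≡.refl , j∉)))

      r≉0 : ¬ r ≈V 0V
      r≉0 r≈0 = r∉ (≈0V⇒∈⟨⟩ u r≈0)

      multiple : ∃[ a ] F a × vec j ≈V a · r
      multiple = dim-one⇒multiple F-sub (weight-one r (vec-∈ _) r≉0 r∉)
                   (vec-∈ _ , ⟨⟩-refl r) r≉0 (vec-∈ j , point≡⇒∈⟨⟩ r≉0 r-point)

    scalar : Carrier
    scalar = proj₁ multiple

    vec≈scalar· : vec j ≈V scalar · vec representative
    vec≈scalar· = proj₂ (proj₂ multiple)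

    scalar≉0 : ¬ scalar ≈ 0#
    scalar≉0 = ≈·⇒scalar≉0 vec≈scalar· (λ j≈0 → j∉ (≈0V⇒∈⟨⟩ u j≈0))

    scalarF : Σ Carrier F
    scalarF = scalar , proj₁ (proj₂ multiple)

    index : Fin p
    index = fromWithout cardF zeroF scalarF scalar≉0

  classify : ∀ j → Dec (⟨ u ⟩ (vec j)) → Fin (q ^ i) ⊎ Fin (suc Q * p)
  classify j (yes j∈) = inj₁ (S.encode (vec j) (vec-∈ j , j∈))
  classify j (no j∉)  = inj₂ (Inverse.from *↔× (point (vec j) , Outside.index j j∉))

  classify-injective : ∀ j j′ d d′ → classify j d ≡ classify j′ d′ → vec j ≈V vec j′
  classify-injective j j′ (yes j∈) (yes j′∈) eq = S.encode-injective _ _ (inj₁-injective eq)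
  classify-injective j j′ (no j∉)  (no j′∉)  eq =
    ≈V-trans (Outside.vec≈scalar· j j∉)
      (≈V-trans (·-cong scalar≈ (≈V-reflexive (≡.cong vec representative≡)))
        (≈V-sym (Outside.vec≈scalar· j′ j′∉)))
    where
    point×index≡ = from-injective *↔× (inj₂-injective eq)
    representative≡ : Outside.representative j j∉ ≡ Outside.representative j′ j′∉
    representative≡ =
      choose-cong onPoint? (≡.cong proj₁ point×index≡) (j , ≡.refl , j∉) (j′ , ≡.refl , j′∉)
    scalar≈ : Outside.scalar j j∉ ≈ Outside.scalar j′ j′∉
    scalar≈ = fromWithout-injective cardF zeroF {Outside.scalarF j j∉} {Outside.scalarF j′ j′∉}
                (Outside.scalar≉0 j j∉) (Outside.scalar≉0 j′ j′∉) (≡.cong proj₂ point×index≡)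

  classification : Fin (q ^ n) → Fin (q ^ i + suc Q * p)
  classification j = Inverse.from +↔⊎ (classify j (⟨⟩-dec u≉0 (vec j)))

  classification-injective : ∀ {j j′} → classification j ≡ classification j′ → j ≡ j′
  classification-injective {j} {j′} eq = U.decode-injective F-sub
    (classify-injective j j′ (⟨⟩-dec u≉0 (vec j)) (⟨⟩-dec u≉0 (vec j′))
      (from-injective +↔⊎ eq))

  club-bound : q ^ n ≤ q ^ i + suc Q * p
  club-bound = FinP.injective⇒≤ classification-injective

^-cancelˡ-< : ∀ m .{{_ : NonZero m}} {n o} → m ^ n < m ^ o → n < o
^-cancelˡ-< m {n} {o} mⁿ<mᵒ with n <? o
... | yes n<o = n<o
... | no n≮o  = contradiction (^-monoʳ-≤ m (≮⇒≥ n≮o)) (<⇒≱ mⁿ<mᵒ)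

1<[1+p]^ : ∀ p .{{_ : NonZero p}} {k} → 1 ≤ k → 1 < suc p ^ k
1<[1+p]^ p {k} 1≤k = ^-monoʳ-< (suc p) (s≤s (>-nonZero⁻¹ p)) 1≤k

sum-bound : ∀ p .{{_ : NonZero p}} {x y} → 1 < x → suc p * x ≤ y → x + suc y * p < suc p * y
sum-bound p {x} {y} 1<x [1+p]x≤y = begin-strict
  x + suc y * p   ≡⟨ +-assoc x p (y * p) ⟨
  x + p + y * p   <⟨ +-monoˡ-< (y * p) x+p<y ⟩
  y + y * p       ≡⟨ ≡.cong (y +_) (*-comm y p) ⟩
  suc p * y       ∎
  where
  open ≤-Reasoning
  x+p<y : x + p < y
  x+p<y = begin-strict
    x + p       <⟨ +-monoʳ-< x (m<m*n p x 1<x) ⟩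
    suc p * x   ≤⟨ [1+p]x≤y ⟩
    y           ∎

club-arithmetic : ∀ p .{{_ : NonZero p}} {m i n} → 1 ≤ m → 1 ≤ i →
                  suc p ^ n ≤ suc p ^ i + suc (suc p ^ m) * p →
                  (i ≤ m ∸ 1 → n ≤ m) × (i ≡ m → n ≤ m + 1)
club-arithmetic p {m@(suc m′)} {i} {n} 1≤m 1≤i bound = i<m⇒n≤m , i≡m⇒n≤m+1
  where
  open ≤-Reasoning
  q = suc p

  i<m⇒n≤m : i ≤ m′ → n ≤ m
  i<m⇒n≤m i≤m′ = s≤s⁻¹ (^-cancelˡ-< q (begin-strict
    q ^ n                     ≤⟨ bound ⟩
    q ^ i + suc (q ^ m) * p   <⟨ sum-bound p (1<[1+p]^ p 1≤i) (^-monoʳ-≤ q (s≤s i≤m′)) ⟩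
    q ^ suc m                 ∎))

  i≡m⇒n≤m+1 : i ≡ m → n ≤ m + 1
  i≡m⇒n≤m+1 ≡.refl = ≡.subst (n ≤_) (+-comm 1 m) (s≤s⁻¹ (^-cancelˡ-< q (begin-strict
    q ^ n                         ≤⟨ bound ⟩
    q ^ m + suc (q ^ m) * p       ≤⟨ +-monoʳ-≤ (q ^ m) (*-monoˡ-≤ p (s≤s (m≤n*m (q ^ m) q))) ⟩
    q ^ m + suc (q ^ suc m) * p   <⟨ sum-bound p (1<[1+p]^ p 1≤m) ≤-refl ⟩
    q ^ suc (suc m)               ∎)))

primePower>1 : ∀ {q} → IsPrimePower q → 1 < q
primePower>1 (p , k , p-prime , ≡.refl) =
  <-≤-trans (nonTrivial⇒n>1 p {{prime⇒nonTrivial p-prime}})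
            (m≤m*n p (p ^ k) {{m^n≢0 p k {{prime⇒nonZero p-prime}}}})

proposition4p9 : (q m i n : ℕ) → IsPrimePower q → 1 ≤ m → 1 ≤ i
    → (K : CommutativeRing 0ℓ 0ℓ) → IsField K
    → HasCard (CommutativeRing.setoid K) (q ^ m)
    → (F : CommutativeRing.Carrier K → Set) → IsSubfield K F
    → HasCard (SubSetoid K F) q
    → (U : V K → Set) → IsSubspace K F U → HasDim K F U n
    → IsClub K F U i
    → ((i ≤ m ∸ 1 → n ≤ m) × (i ≡ m → n ≤ m + 1))
proposition4p9 q m i n q-prime-power 1≤m 1≤i K K-field cardK F F-sub cardF U U-sub dimU club
  with primePower>1 q-prime-power
... | s≤s (s≤s {n = t} _) =
  club-arithmetic (suc t) 1≤m 1≤i (ClubBound.club-bound K-field cardK F-sub cardF U-sub dimU club)
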